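{- Let $d \ge 1$ be an integer, let $n_1,\dots,n_d$ be positive integers, and let $M \subset \mathcal{P}([d])$ be non-empty with $[d] \notin M$. Let $A_1, A_2 \subset [n_1]\times\dots\times[n_d]$ be in diagonal sum, i.e. there exist $X_j^1, X_j^2 \subset [n_j]$ for $j \in [d]$ with $X_j^1 \cap X_j^2 = \emptyset$ for every $j\in[d]$, such that $A_1 \subset X_1^1\times\dots\times X_d^1$ and $A_2 \subset X_1^2\times\dots\times X_d^2$. Then \[\mathrm{c}_M(A_1 \cup A_2) = \mathrm{c}_M(A_1) + \mathrm{c}_M(A_2).\]
   Context: $[k]=\{1,\dots,k\}$. For $B \subset [d]$, a $B$-subspace is a maximal subset $S$ of $[n_1]\times\dots\times[n_d]$ such that $x_i = y_i$ whenever $x,y\in S$ and $i \notin B$ (equivalently, a set of the form $\{x : x_i = a_i \text{ for all } i\notin B\}$); its order is $|B|$. For non-empty $M\subset\mathcal{P}([d])$, an $M$-subspace is a $B$-subspace for some $B\in M$. The $M$-covering number $\mathrm{c}_M(A)$ of $A\subset[n_1]\times\dots\times[n_d]$ is the smallest nonnegative integer $k$ such that $A$ is contained in a union of $k$ $M$-subspaces. -}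

module Defs where

open import Data.Nat using (ℕ; _<_)
open import Data.Fin using (Fin)
open import Data.Fin.Subset using (Subset; _∈_; _∉_)
open import Data.Sum using (_⊎_)
open import Data.Product using (Σ; ∃; _×_; proj₁; proj₂)
open import Relation.Binary.PropositionalEquality using (_≡_)
open import Relation.Nullary using (¬_)

-- Points of [n_1] × ... × [n_d]; coordinate i ranges over Fin (n i)
-- (i.e. {0,...,n_i - 1}, a relabelling of [n_i]).
Point : {d : ℕ} → (Fin d → ℕ) → Set
Point {d} n = (i : Fin d) → Fin (n i)

Grid-Subset : {d : ℕ} → (Fin d → ℕ) → Set₁
Grid-Subset n = Point n → Set

-- A B-subspace is determined by B and a base point a:
-- { x : x i = a i for all i ∉ B }.
record Subspace {d : ℕ} (n : Fin d → ℕ) : Set where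
  constructor subspace
  field
    dirs : Subset d
    base : Point n

open Subspace public

_∈S_ : {d : ℕ} {n : Fin d → ℕ} → Point n → Subspace n → Set
_∈S_ {d} x S = (i : Fin d) → i ∉ dirs S → x i ≡ base S i

CoverableBy : {d : ℕ} {n : Fin d → ℕ} → (Subset d → Set) → Grid-Subset n → ℕ → Set
CoverableBy {d} {n} M A k =
  Σ (Fin k → Subspace n) λ S →
    ((t : Fin k) → M (dirs (S t))) ×
    ((x : Point n) → A x → ∃ λ t → x ∈S S t)

IsCoveringNumber : {d : ℕ} {n : Fin d → ℕ} → (Subset d → Set) → Grid-Subset n → ℕ → Set
IsCoveringNumber M A k = CoverableBy M A k × ((j : ℕ) → j < k → ¬ CoverableBy M A j)

_∪G_ : {d : ℕ} {n : Fin d → ℕ} → Grid-Subset n → Grid-Subset n → Grid-Subset n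
(A ∪G A') x = A x ⊎ A' x

{-# OPTIONS --safe #-}
module Submission where

-- Concatenating optimal covers of A₁ and A₂ covers the union. Conversely, an
-- M-subspace is not the whole grid, so it fixes some coordinate i, and it cannot meet both
-- A₁ and A₂ since their i-th coordinates range over disjoint sets. Hence any cover of the
-- union splits into a cover of A₁ and a cover of A₂, and its size is at least c_M(A₁) + c_M(A₂).
-- Deciding which members of the cover meet A₁ is only possible under a double negation,
-- which suffices because the conclusion of minimality is a negation.

open import Defs
open import Function using (_∘_)
open import Data.Nat using (ℕ; _≤_; _+_; _<_; zero; suc)
open import Data.Nat.Properties using (+-comm; _<?_; ≮⇒≥; +-monoˡ-≤; +-cancelˡ-<; ≤-<-trans)
open import Data.Fin using (Fin; splitAt; _↑ˡ_; _↑ʳ_; lift) renaming (zero to fzero; suc to fsuc)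
open import Data.Fin.Properties using (splitAt-↑ˡ; splitAt-↑ʳ; sequence)
open import Data.Fin.Subset using (Subset; ⊤)
open import Data.Fin.Subset.Properties using (_∈?_; ⊆⊤; ⊆-antisym)
open import Data.Product using (∃; ∃₂; _,_; _×_)
open import Data.Sum using (_⊎_; inj₁; inj₂; [_,_]; swap; map; map₁; map₂)
open import Data.Empty using (⊥; ⊥-elim)
open import Effect.Monad using (RawMonad)
open import Relation.Nullary using (¬_; Dec; yes; no)
open import Relation.Nullary.Decidable using (toSum; decidable-stable; ¬¬-excluded-middle)
open import Relation.Nullary.Negation using (¬¬-Monad; ¬¬-map)
open import Relation.Binary.PropositionalEquality using (_≡_; refl; sym; trans; cong; subst)

m+n<o+p⇒m<o⊎n<p : ∀ m n o p → m + n < o + p → m < o ⊎ n < p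
m+n<o+p⇒m<o⊎n<p m n o p m+n<o+p with m <? o
... | yes m<o = inj₁ m<o
... | no m≮o = inj₂ (+-cancelˡ-< o n p (≤-<-trans (+-monoˡ-≤ n (≮⇒≥ m≮o)) m+n<o+p))

Image : ∀ {a j} → (Fin a → Fin j) → Fin j → Set
Image g t = ∃ λ s → g s ≡ t

record Partition {j : ℕ} (Q R : Fin j → Set) : Set where
  field
    size₁ size₂ : ℕ
    sizes : size₁ + size₂ ≡ j
    part₁ : Fin size₁ → Fin j
    part₂ : Fin size₂ → Fin j
    part₁-Q : ∀ s → Q (part₁ s)
    part₂-R : ∀ s → R (part₂ s)
    covers : ∀ t → Image part₁ t ⊎ Image part₂ t

Partition-swap : ∀ {j} {Q R : Fin j → Set} → Partition Q R → Partition R Q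
Partition-swap P = record
  { size₁ = size₂ ; size₂ = size₁ ; sizes = trans (+-comm size₂ size₁) sizes
  ; part₁ = part₂ ; part₂ = part₁ ; part₁-Q = part₂-R ; part₂-R = part₁-Q
  ; covers = swap ∘ covers }
  where open Partition P

Partition-cons : ∀ {j} {Q R : Fin (suc j) → Set} →
                 Q fzero → Partition (Q ∘ fsuc) (R ∘ fsuc) → Partition Q R
Partition-cons q P = record
  { size₁ = suc size₁ ; size₂ = size₂ ; sizes = cong suc sizes
  ; part₁ = lift 1 part₁ ; part₂ = fsuc ∘ part₂
  ; part₁-Q = λ { fzero → q ; (fsuc s) → part₁-Q s }
  ; part₂-R = part₂-R
  ; covers = λ { fzero → inj₁ (fzero , refl)
               ; (fsuc t) → map (λ { (s , e) → fsuc s , cong fsuc e })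
                                (λ { (s , e) → s , cong fsuc e }) (covers t) } }
  where open Partition P

partition : ∀ {j} {Q R : Fin j → Set} → (∀ t → Q t ⊎ R t) → Partition Q R
partition {zero} _ = record
  { size₁ = 0 ; size₂ = 0 ; sizes = refl ; part₁ = λ () ; part₂ = λ ()
  ; part₁-Q = λ () ; part₂-R = λ () ; covers = λ () }
partition {suc j} Q⊎R with Q⊎R fzero
... | inj₁ q = Partition-cons q (partition (Q⊎R ∘ fsuc))
... | inj₂ r = Partition-swap (Partition-cons r (partition (swap ∘ Q⊎R ∘ fsuc)))

module _ {d : ℕ} {n : Fin d → ℕ} where

  Meets : Grid-Subset n → Subspace n → Set
  Meets A S = ∃ λ x → A x × x ∈S S

  module _ (M : Subset d → Set) where

    CoverableBy-∪ : ∀ {A₁ A₂ : Grid-Subset n} {k₁ k₂} →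
                    CoverableBy M A₁ k₁ → CoverableBy M A₂ k₂ → CoverableBy M (A₁ ∪G A₂) (k₁ + k₂)
    CoverableBy-∪ {A₁} {A₂} {k₁} {k₂} (S₁ , M-S₁ , cover₁) (S₂ , M-S₂ , cover₂) =
      S , (λ t → [_,_] {C = M ∘ dirs ∘ [ S₁ , S₂ ]} M-S₁ M-S₂ (splitAt k₁ t)) , cover
      where
      S : Fin (k₁ + k₂) → Subspace n
      S t = [ S₁ , S₂ ] (splitAt k₁ t)
      cover : ∀ x → (A₁ ∪G A₂) x → ∃ λ t → x ∈S S t
      cover x (inj₁ x∈A₁) with cover₁ x x∈A₁
      ... | u , x∈ = u ↑ˡ k₂ , subst (λ s → x ∈S [ S₁ , S₂ ] s) (sym (splitAt-↑ˡ k₁ u k₂)) x∈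
      cover x (inj₂ x∈A₂) with cover₂ x x∈A₂
      ... | u , x∈ = k₁ ↑ʳ u , subst (λ s → x ∈S [ S₁ , S₂ ] s) (sym (splitAt-↑ʳ k₁ k₂ u)) x∈

    CoverableBy-subfamily : ∀ {A : Grid-Subset n} {j a} (T : Fin j → Subspace n) →
                            (∀ t → M (dirs (T t))) → (∀ x → A x → ∃ λ t → x ∈S T t) →
                            (g : Fin a → Fin j) → (∀ t → Image g t ⊎ ¬ Meets A (T t)) →
                            CoverableBy M A a
    CoverableBy-subfamily {A} T M-T cover g keeps-meeting = T ∘ g , M-T ∘ g , cover′
      where
      cover′ : ∀ x → A x → ∃ λ s → x ∈S T (g s)
      cover′ x x∈A with cover x x∈A
      ... | t , x∈ with keeps-meeting t
      ...   | inj₁ (s , refl) = s , x∈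
      ...   | inj₂ misses = ⊥-elim (misses (x , x∈A , x∈))

module DiagonalSum {d : ℕ} {n : Fin d → ℕ} {A₁ A₂ : Grid-Subset n}
                   {X₁ X₂ : (j : Fin d) → Fin (n j) → Set}
                   (disjoint : (j : Fin d) (y : Fin (n j)) → X₁ j y → X₂ j y → ⊥)
                   (A₁⊆X₁ : (x : Point n) → A₁ x → (j : Fin d) → X₁ j (x j))
                   (A₂⊆X₂ : (x : Point n) → A₂ x → (j : Fin d) → X₂ j (x j)) where

  meets-both⇒dirs≡⊤ : ∀ S → Meets A₁ S → Meets A₂ S → dirs S ≡ ⊤
  meets-both⇒dirs≡⊤ S (x , x∈A₁ , x∈S) (y , y∈A₂ , y∈S) =
    ⊆-antisym ⊆⊤ λ {i} _ → decidable-stable (i ∈? dirs S) λ i∉ →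
      disjoint i (y i) (subst (X₁ i) (trans (x∈S i i∉) (sym (y∈S i i∉))) (A₁⊆X₁ x x∈A₁ i))
                       (A₂⊆X₂ y y∈A₂ i)

  module _ (M : Subset d → Set) (¬M⊤ : ¬ M ⊤) where

    M-subspace-meets-one-side : ∀ {S} → M (dirs S) → Meets A₁ S → ¬ Meets A₂ S
    M-subspace-meets-one-side {S} M-S meets₁ meets₂ =
      ¬M⊤ (subst M (meets-both⇒dirs≡⊤ S meets₁ meets₂) M-S)

    CoverableBy-split : ∀ {j} → CoverableBy M (A₁ ∪G A₂) j →
                        ¬ ¬ ∃₂ λ a b → a + b ≡ j × CoverableBy M A₁ a × CoverableBy M A₂ b
    CoverableBy-split {j} (T , M-T , cover) =
      ¬¬-map split (sequence (RawMonad.rawApplicative ¬¬-Monad) λ _ → ¬¬-excluded-middle)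
      where
      split : ((t : Fin j) → Dec (Meets A₁ (T t))) →
              ∃₂ λ a b → a + b ≡ j × CoverableBy M A₁ a × CoverableBy M A₂ b
      split meets₁? =
        size₁ , size₂ , sizes ,
        CoverableBy-subfamily M T M-T (λ x → cover x ∘ inj₁) part₁ keeps-meeting₁ ,
        CoverableBy-subfamily M T M-T (λ x → cover x ∘ inj₂) part₂ keeps-meeting₂
        where
        open Partition (partition (toSum ∘ meets₁?))
        keeps-meeting₁ : ∀ t → Image part₁ t ⊎ ¬ Meets A₁ (T t)
        keeps-meeting₁ t = map₂ (λ { (s , refl) → part₂-R s }) (covers t)
        keeps-meeting₂ : ∀ t → Image part₂ t ⊎ ¬ Meets A₂ (T t)
        keeps-meeting₂ t = swap (map₁ (λ { (s , refl) → M-subspace-meets-one-side (M-T (part₁ s)) (part₁-Q s) })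
                                      (covers t))

proposition2p1 : (d : ℕ) → 1 ≤ d →
    (n : Fin d → ℕ) → ((i : Fin d) → 1 ≤ n i) →
    (M : Subset d → Set) → ∃ M → ¬ M ⊤ →
    (A₁ A₂ : Grid-Subset n) →
    (X₁ X₂ : (j : Fin d) → Fin (n j) → Set) →
    ((j : Fin d) (y : Fin (n j)) → X₁ j y → X₂ j y → ⊥) →
    ((x : Point n) → A₁ x → (j : Fin d) → X₁ j (x j)) →
    ((x : Point n) → A₂ x → (j : Fin d) → X₂ j (x j)) →
    (k₁ k₂ : ℕ) → IsCoveringNumber M A₁ k₁ → IsCoveringNumber M A₂ k₂ →
    IsCoveringNumber M (A₁ ∪G A₂) (k₁ + k₂)
proposition2p1 d _ n _ M _ ¬M⊤ A₁ A₂ X₁ X₂ disjoint A₁⊆X₁ A₂⊆X₂ k₁ k₂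
               (cover₁ , minimal₁) (cover₂ , minimal₂) =
  CoverableBy-∪ M cover₁ cover₂ , lower-bound
  where
  open DiagonalSum disjoint A₁⊆X₁ A₂⊆X₂
  lower-bound : ∀ j → j < k₁ + k₂ → ¬ CoverableBy M (A₁ ∪G A₂) j
  lower-bound j j<k cover = CoverableBy-split M ¬M⊤ cover λ { (a , b , refl , cover₁′ , cover₂′) →
    [ (λ a<k₁ → minimal₁ a a<k₁ cover₁′) , (λ b<k₂ → minimal₂ b b<k₂ cover₂′) ]
      (m+n<o+p⇒m<o⊎n<p a b k₁ k₂ j<k) }
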